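{- Let $G=(V,E)$ be a strongly connected directed graph and $s\in V$. For vertices $v,w$, if $[v]_{\mathrm{2e}}=[w]_{\mathrm{2e}}$ then $T(v)=T(w)$ and $T^R(v)=T^R(w)$.
   Context: $G(s)$ is the flow graph with start vertex $s$; $u$ dominates $x$ if every path from $s$ to $x$ contains $u$ (reflexive). $D(s)$ is the dominator tree (rooted at $s$, $u$ ancestor of $x$ iff $u$ dominates $x$), and $d(x)$ the parent of $x\neq s$. An edge $(u,x)$ is a bridge of $G(s)$ if every path from $s$ to $x$ contains it (then $u=d(x)$). A vertex $x$ is marked if $(d(x),x)$ is a bridge of $G(s)$. Deleting from $D(s)$ all edges $(d(x),x)$ with $x$ marked yields a forest; $T(v)$ denotes the tree of this forest containing $v$. $T^R(v)$ is defined in the same way using the reverse graph $G^R$ (all edges reversed), the flow graph $G^R(s)$, its dominator tree $D^R(s)$ and its bridges. Two vertices are $2$-edge-connected if there are two edge-disjoint paths in each direction between them; $[v]_{\mathrm{2e}}$ is the $2$-edge-connected block (equivalence class) of $v$. -}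

module Defs where

open import Data.Nat using (ℕ)
open import Data.Fin using (Fin)
open import Data.List using (List; []; _∷_)
open import Data.List.Membership.Propositional using (_∈_; _∉_)
open import Data.Product using (Σ; ∃; _×_; _,_)
open import Relation.Binary.PropositionalEquality using (_≡_)
open import Relation.Nullary using (¬_)

record Digraph : Set where
  field
    n   : ℕ
    m   : ℕ
    src : Fin m → Fin n
    tgt : Fin m → Fin n
open Digraph public

Vertex : Digraph → Set
Vertex G = Fin (n G)

Edge : Digraph → Set
Edge G = Fin (m G)

rev : Digraph → Digraph
rev G = record { n = n G ; m = m G ; src = tgt G ; tgt = src G }

data Walk (G : Digraph) : Vertex G → Vertex G → Set where
  []  : ∀ {x} → Walk G x x
  _∷_ : ∀ {y} (e : Edge G) → Walk G (tgt G e) y → Walk G (src G e) y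

edgesOf : ∀ {G x y} → Walk G x y → List (Edge G)
edgesOf []      = []
edgesOf (e ∷ p) = e ∷ edgesOf p

verticesOf : ∀ {G x y} → Walk G x y → List (Vertex G)
verticesOf {x = x} []      = x ∷ []
verticesOf {G} (e ∷ p)     = src G e ∷ verticesOf p

StronglyConnected : Digraph → Set
StronglyConnected G = ∀ (x y : Vertex G) → Walk G x y

Dominates : (G : Digraph) (s u x : Vertex G) → Set
Dominates G s u x = ∀ (p : Walk G s x) → u ∈ verticesOf p

-- u = d(x): the parent of x in the dominator tree D(s), i.e. the immediate dominator
IDom : (G : Digraph) (s u x : Vertex G) → Set
IDom G s u x =
  ¬ (x ≡ s) × Dominates G s u x × ¬ (u ≡ x) ×
  (∀ w → Dominates G s w x → ¬ (w ≡ x) → Dominates G s w u)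

Bridge : (G : Digraph) (s : Vertex G) (e : Edge G) → Set
Bridge G s e = ∀ (p : Walk G s (tgt G e)) → e ∈ edgesOf p

Marked : (G : Digraph) (s x : Vertex G) → Set
Marked G s x =
  Σ (Vertex G) λ u → IDom G s u x ×
    Σ (Edge G) λ e → src G e ≡ u × tgt G e ≡ x × Bridge G s e

-- r is an ancestor of v in the forest obtained from D(s) by deleting the
-- edges (d(x),x) with x marked
data ForestAnc (G : Digraph) (s : Vertex G) (r : Vertex G) : Vertex G → Set where
  here : ForestAnc G s r r
  up   : ∀ {u x} → IDom G s u x → ¬ Marked G s x → ForestAnc G s r u → ForestAnc G s r x

SameTree : (G : Digraph) (s v w : Vertex G) → Set
SameTree G s v w = ∃ λ r → ForestAnc G s r v × ForestAnc G s r w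

EdgeDisjoint : ∀ {G a b c d} → Walk G a b → Walk G c d → Set
EdgeDisjoint p q = ∀ e → e ∈ edgesOf p → e ∉ edgesOf q

TwoEdgeConnected : (G : Digraph) (v w : Vertex G) → Set
TwoEdgeConnected G v w =
  (Σ (Walk G v w) λ p → Σ (Walk G v w) λ q → EdgeDisjoint p q) ×
  (Σ (Walk G w v) λ p → Σ (Walk G w v) λ q → EdgeDisjoint p q)

module Submission where

-- Work in a flow graph G(s) (every vertex reachable from s).
-- Climbing the dominator tree from a vertex x through unmarked vertices stops
-- at the root of T(x), which is s or a marked vertex.  The heart of the argument
-- is a bridge lemma: if (d(r),r) is a bridge, r dominates v, and w has two
-- edge-disjoint walks to v, then r dominates w, since a walk from s to w avoiding
-- r, continued along either walk to v, would cross the bridge inside it.  A marked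
-- dominator of a vertex y also dominates the root of T(y) (it cannot sit strictly
-- inside the unmarked chain), so the roots of T(v) and T(w) dominate each other
-- and coincide.  The statement for G^R follows by reversing all walks.

open import Defs
open import Data.Product using (_×_; Σ; _,_; proj₁; proj₂)
open import Data.Nat as ℕ using (ℕ; zero; suc; _+_; z≤n; s≤s)
import Data.Nat.Properties as ℕP
open import Data.Nat.Induction using (<-wellFounded)
open import Induction.WellFounded using (Acc; acc)
open import Data.Fin as F using (Fin)
open import Data.Fin.Properties using (_≟_; any?; pigeonhole)
open import Data.List as L using (List; []; _∷_; length; allFin) renaming (_++_ to _++ₗ_)
open import Data.List.Membership.Propositional using (_∈_; _∉_)
open import Data.List.Membership.Propositional.Properties using (∈-allFin; ∈-lookup; ∈-++⁺ˡ; ∈-++⁻)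
open import Data.List.Membership.DecPropositional using () renaming (_∈?_ to member?)
open import Data.List.Relation.Unary.Any using (here; there)
open import Data.List.Relation.Unary.All as All using (All; []; _∷_)
import Data.List.Relation.Unary.All.Properties as AllP
open import Data.List.Relation.Unary.AllPairs using ([]; _∷_)
open import Data.List.Relation.Unary.Unique.Propositional using (Unique)
open import Data.Sum using (_⊎_; inj₁; inj₂)
open import Data.Empty using (⊥; ⊥-elim)
open import Relation.Nullary using (¬_; Dec; yes; no; ¬?)
open import Relation.Nullary.Decidable using (_×-dec_)
open import Relation.Unary using (Decidable)
open import Relation.Binary.PropositionalEquality using (_≡_; refl; sym; trans; cong; subst)

unique-lookup : ∀ {A : Set} (xs : List A) → Unique xs →
                ∀ i j → i F.< j → ¬ L.lookup xs i ≡ L.lookup xs j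
unique-lookup (x ∷ xs) (x∉xs ∷ _) Fin.zero (Fin.suc j) _ eq = All.lookup x∉xs (∈-lookup j) eq
unique-lookup (x ∷ xs) (_ ∷ u) (Fin.suc i) (Fin.suc j) (s≤s i<j) eq = unique-lookup xs u i j i<j eq

unique-length≤ : ∀ {k} (xs : List (Fin k)) → Unique xs → length xs ℕ.≤ k
unique-length≤ xs u = ℕP.≮⇒≥ λ k<len →
  let (i , j , i<j , eq) = pigeonhole k<len (L.lookup xs) in unique-lookup xs u i j i<j eq

module Walks (G : Digraph) where
  V = Vertex G
  E = Edge G

  infixr 5 _++w_
  _++w_ : ∀ {a b c} → Walk G a b → Walk G b c → Walk G a c
  []      ++w q = q
  (e ∷ p) ++w q = e ∷ (p ++w q)

  len : ∀ {a b} → Walk G a b → ℕ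
  len []      = 0
  len (e ∷ p) = suc (len p)

  len-++ : ∀ {a b c} (p : Walk G a b) (q : Walk G b c) → len (p ++w q) ≡ len p + len q
  len-++ []      q = refl
  len-++ (e ∷ p) q = cong suc (len-++ p q)

  verticesOf-length : ∀ {a b} (p : Walk G a b) → length (verticesOf p) ≡ suc (len p)
  verticesOf-length []      = refl
  verticesOf-length (e ∷ p) = cong suc (verticesOf-length p)

  edgesOf-++ : ∀ {a b c} (p : Walk G a b) (q : Walk G b c) →
               edgesOf (p ++w q) ≡ edgesOf p ++ₗ edgesOf q
  edgesOf-++ []      q = refl
  edgesOf-++ (e ∷ p) q = cong (e ∷_) (edgesOf-++ p q)

  ∈-edges-++ˡ : ∀ {a b c e} (p : Walk G a b) (q : Walk G b c) →
                e ∈ edgesOf p → e ∈ edgesOf (p ++w q)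
  ∈-edges-++ˡ p q m = subst (_ ∈_) (sym (edgesOf-++ p q)) (∈-++⁺ˡ m)

  ∈-edges-++⁻ : ∀ {a b c e} (p : Walk G a b) (q : Walk G b c) →
                e ∈ edgesOf (p ++w q) → e ∈ edgesOf p ⊎ e ∈ edgesOf q
  ∈-edges-++⁻ p q m = ∈-++⁻ (edgesOf p) (subst (_ ∈_) (edgesOf-++ p q) m)

  ∈-vertices-++ˡ : ∀ {a b c z} (p : Walk G a b) (q : Walk G b c) →
                   z ∈ verticesOf p → z ∈ verticesOf (p ++w q)
  ∈-vertices-++ˡ []      []      m         = m
  ∈-vertices-++ˡ []      (e ∷ q) (here eq) = here eq
  ∈-vertices-++ˡ (e ∷ p) q       (here eq) = here eq
  ∈-vertices-++ˡ (e ∷ p) q       (there m) = there (∈-vertices-++ˡ p q m)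

  start∈ : ∀ {a b} (p : Walk G a b) → a ∈ verticesOf p
  start∈ []      = here refl
  start∈ (e ∷ p) = here refl

  end∈ : ∀ {a b} (p : Walk G a b) → b ∈ verticesOf p
  end∈ []      = here refl
  end∈ (e ∷ p) = there (end∈ p)

  tgt∈ : ∀ {a b e} (p : Walk G a b) → e ∈ edgesOf p → tgt G e ∈ verticesOf p
  tgt∈ (e ∷ p) (here refl) = there (start∈ p)
  tgt∈ (e ∷ p) (there m)   = there (tgt∈ p m)

  split : ∀ {a b z} (p : Walk G a b) → z ∈ verticesOf p →
          Σ (Walk G a z) λ q → Σ (Walk G z b) λ r → p ≡ q ++w r
  split []      (here refl) = [] , [] , refl
  split (e ∷ p) (here refl) = [] , e ∷ p , refl
  split (e ∷ p) (there m) with split p m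
  ... | q , r , eq = e ∷ q , r , cong (e ∷_) eq

  prefix≤ : ∀ {a b u} (p : Walk G a b) → u ∈ verticesOf p → Σ (Walk G a u) λ q → len q ℕ.≤ len p
  prefix≤ p m with split p m
  ... | q , r , refl = q , subst (len q ℕ.≤_) (sym (len-++ q r)) (ℕP.m≤m+n (len q) (len r))

  prefix< : ∀ {a b u} (p : Walk G a b) → u ∈ verticesOf p → ¬ u ≡ b →
            Σ (Walk G a u) λ q → len q ℕ.< len p
  prefix< p m u≢b with split p m
  ... | q , [] , refl = ⊥-elim (u≢b refl)
  ... | q , e ∷ r , refl =
    q , subst (len q ℕ.<_) (sym (len-++ q (e ∷ r))) (ℕP.m<m+n (len q) (s≤s z≤n))

  unique-suffix : ∀ {a b c} (p : Walk G a b) (q : Walk G b c) →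
                  Unique (verticesOf (p ++w q)) → Unique (verticesOf q)
  unique-suffix []      q u       = u
  unique-suffix (e ∷ p) q (_ ∷ u) = unique-suffix p q u

  all-edges-suffix : ∀ {Q : E → Set} {a b c} (p : Walk G a b) (q : Walk G b c) →
                     All Q (edgesOf (p ++w q)) → All Q (edgesOf q)
  all-edges-suffix []      q al       = al
  all-edges-suffix (e ∷ p) q (_ ∷ al) = all-edges-suffix p q al

  -- A walk avoids u when u is neither its start nor the target of any edge;
  -- unlike u ∉ verticesOf p, this splits well over concatenations.
  Avoids : V → ∀ {a b} → Walk G a b → Set
  Avoids u {a} p = ¬ (a ≡ u) × All (λ e → ¬ (tgt G e ≡ u)) (edgesOf p)

  avoids⇒∉ : ∀ {u a b} (p : Walk G a b) → Avoids u p → u ∉ verticesOf p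
  avoids⇒∉ []      (a≢u , [])    (here eq) = a≢u (sym eq)
  avoids⇒∉ (e ∷ p) (a≢u , _)     (here eq) = a≢u (sym eq)
  avoids⇒∉ (e ∷ p) (_ , t≢u ∷ al) (there m) = avoids⇒∉ p (t≢u , al) m

  ∉⇒avoids : ∀ {u a b} (p : Walk G a b) → u ∉ verticesOf p → Avoids u p
  ∉⇒avoids []      u∉p = (λ eq → u∉p (here (sym eq))) , []
  ∉⇒avoids (e ∷ p) u∉p with ∉⇒avoids p (λ m → u∉p (there m))
  ... | t≢u , al = (λ eq → u∉p (here (sym eq))) , t≢u ∷ al

  avoids-++ : ∀ {u a b c} (p : Walk G a b) (q : Walk G b c) → Avoids u p →
              All (λ e → ¬ (tgt G e ≡ u)) (edgesOf q) → Avoids u (p ++w q)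
  avoids-++ p q (a≢u , alp) alq = a≢u , subst (All _) (sym (edgesOf-++ p q)) (AllP.++⁺ alp alq)

  lastOccurrence : ∀ {a b} (P : V → Set) → Decidable P → (t : Walk G a b) →
                   All (λ e → ¬ P (tgt G e)) (edgesOf t) ⊎
                   Σ V λ z → P z × Σ (Walk G z b) λ tail → All (λ e → ¬ P (tgt G e)) (edgesOf tail)
  lastOccurrence P P? [] = inj₁ []
  lastOccurrence P P? (e ∷ t) with lastOccurrence P P? t
  ... | inj₂ later = inj₂ later
  ... | inj₁ none with P? (tgt G e)
  ...   | yes pt = inj₂ (tgt G e , pt , t , none)
  ...   | no ¬pt = inj₁ (¬pt ∷ none)

-- Reachability along a decidable set Q of edges is decidable: a Q-walk can be
-- shortcut to a simple one, which has fewer than n G edges, so a bounded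
-- exhaustive search suffices.
module QReachability (G : Digraph) {Q : Edge G → Set} (Q? : Decidable Q) where
  open Walks G

  QWalk : V → V → Set
  QWalk a b = Σ (Walk G a b) λ p → All Q (edgesOf p)

  boundedQWalk? : ∀ k a b → Dec (Σ (QWalk a b) λ (p , _) → len p ℕ.≤ k)
  boundedQWalk? k a b with a ≟ b
  ... | yes refl = yes (([] , []) , z≤n)
  boundedQWalk? zero a b | no a≢b =
    no λ { (([] , _) , _) → a≢b refl ; ((e ∷ p , _) , ()) }
  boundedQWalk? (suc k) a b | no a≢b
    with any? (λ e → (src G e ≟ a) ×-dec (Q? e ×-dec boundedQWalk? k (tgt G e) b))
  ... | yes (e , refl , qe , (p , al) , p≤k) = yes ((e ∷ p , qe ∷ al) , s≤s p≤k)
  ... | no none = no λ { (([] , _) , _) → a≢b refl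
                       ; ((e ∷ p , qe ∷ al) , s≤s p≤k) → none (e , refl , qe , (p , al) , p≤k) }

  shortcut : ∀ {a b} → QWalk a b → Σ (QWalk a b) λ (p , _) → Unique (verticesOf p)
  shortcut ([] , []) = ([] , []) , [] ∷ []
  shortcut (e ∷ p , qe ∷ al) with shortcut (p , al)
  ... | (p' , al') , u' with member? _≟_ (src G e) (verticesOf p')
  ...   | no src∉p' = (e ∷ p' , qe ∷ al') , AllP.¬Any⇒All¬ _ src∉p' ∷ u'
  ...   | yes src∈p' with split p' src∈p'
  ...     | q , r , refl = (r , all-edges-suffix q r al') , unique-suffix q r u'

  qWalk? : ∀ a b → Dec (QWalk a b)
  qWalk? a b with boundedQWalk? (n G) a b
  ... | yes (w , _) = yes w
  ... | no none = no λ w →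
    let ((p , al) , u) = shortcut w
        bound = subst (ℕ._≤ n G) (verticesOf-length p) (unique-length≤ (verticesOf p) u)
    in none ((p , al) , ℕP.≤-trans (ℕP.n≤1+n (len p)) bound)

module Dominance (G : Digraph) (s : Vertex G) where
  open Walks G

  Dom : V → V → Set
  Dom = Dominates G s

  dom-s : ∀ x → Dom s x
  dom-s x = start∈

  dom-refl : ∀ x → Dom x x
  dom-refl x = end∈

  dom-of-s : ∀ {u} → Dom u s → u ≡ s
  dom-of-s u-dom-s with u-dom-s []
  ... | here eq = eq

  dom-trans : ∀ {a u x} → Dom a u → Dom u x → Dom a x
  dom-trans a-dom-u u-dom-x p with split p (u-dom-x p)
  ... | q , r , refl = ∈-vertices-++ˡ q r (a-dom-u q)

  AvoidingWalk : V → V → Set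
  AvoidingWalk u y = Σ (Walk G s y) (Avoids u)

  avoidingWalk? : ∀ u y → Dec (AvoidingWalk u y)
  avoidingWalk? u y with s ≟ u
  ... | yes s≡u = no λ (_ , s≢u , _) → s≢u s≡u
  ... | no s≢u with QReachability.qWalk? G (λ e → ¬? (tgt G e ≟ u)) s y
  ...   | yes (p , al) = yes (p , s≢u , al)
  ...   | no none = no λ (p , _ , al) → none (p , al)

  dom⇒¬avoiding : ∀ {u y} → Dom u y → ¬ AvoidingWalk u y
  dom⇒¬avoiding u-dom-y (p , av) = avoids⇒∉ p av (u-dom-y p)

  ¬avoiding⇒dom : ∀ {u y} → ¬ AvoidingWalk u y → Dom u y
  ¬avoiding⇒dom {u} none p with member? _≟_ u (verticesOf p)
  ... | yes u∈p = u∈p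
  ... | no u∉p = ⊥-elim (none (p , ∉⇒avoids p u∉p))

  dom? : ∀ u y → Dec (Dom u y)
  dom? u y with avoidingWalk? u y
  ... | yes aw = no λ d → dom⇒¬avoiding d aw
  ... | no none = yes (¬avoiding⇒dom none)

  ¬dom⇒avoiding : ∀ {u y} → ¬ Dom u y → AvoidingWalk u y
  ¬dom⇒avoiding {u} {y} ¬dom with avoidingWalk? u y
  ... | yes aw = aw
  ... | no none = ⊥-elim (¬dom (¬avoiding⇒dom none))

  bridge-on-walk : ∀ {e y} → Bridge G s e → (p : Walk G s y) → tgt G e ∈ verticesOf p → e ∈ edgesOf p
  bridge-on-walk br p m with split p m
  ... | q , r , refl = ∈-edges-++ˡ q r (br q)

  -- Otherwise some walk p from s
  -- to w avoids x, and each p ++ q must use the bridge inside q.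
  bridge-lemma : ∀ {e v w} → Bridge G s e → Dom (tgt G e) v →
                 (q₁ q₂ : Walk G w v) → EdgeDisjoint q₁ q₂ → Dom (tgt G e) w
  bridge-lemma {e} {v} {w} br x-dom-v q₁ q₂ disjoint p with member? _≟_ (tgt G e) (verticesOf p)
  ... | yes x∈p = x∈p
  ... | no x∉p = ⊥-elim (disjoint e (bridge-on q₁) (bridge-on q₂))
    where
    bridge-on : (q : Walk G w v) → e ∈ edgesOf q
    bridge-on q with ∈-edges-++⁻ p q (bridge-on-walk br (p ++w q) (x-dom-v (p ++w q)))
    ... | inj₁ e∈p = ⊥-elim (x∉p (tgt∈ p e∈p))
    ... | inj₂ e∈q = e∈q

module FlowGraph (G : Digraph) (s : Vertex G) (reach : ∀ x → Walk G s x) where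
  open Walks G
  open Dominance G s

  -- If a ≠ b dominate each other, every walk s → a has a strictly shorter one.
  antisym : ∀ {a b} → Dom a b → Dom b a → a ≡ b
  antisym {a} {b} a-dom-b b-dom-a with a ≟ b
  ... | yes a≡b = a≡b
  ... | no a≢b = ⊥-elim (descend (reach a) (<-wellFounded _))
    where
    descend : (p : Walk G s a) → Acc ℕ._<_ (len p) → ⊥
    descend p (acc shorter) =
      let (q , q<p) = prefix< p (b-dom-a p) (λ b≡a → a≢b (sym b≡a))
          (q' , q'≤q) = prefix≤ q (a-dom-b q)
      in descend q' (shorter (ℕP.≤-<-trans q'≤q q<p))

  -- Two dominators w, u of x are comparable: if w does not dominate u, take a
  -- walk s → u avoiding w; a walk s → w avoiding u would, glued to the tail of
  -- a walk s → x after its last visit to u or w, yield a walk avoiding w or u.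
  comparable : ∀ w u x → Dom w x → Dom u x → ¬ Dom w u → Dom u w
  comparable w u x w-dom-x u-dom-x ¬w-dom-u = ¬avoiding⇒dom λ (r , r-avoids-u) → go r r-avoids-u
    where
    UW : V → Set
    UW z = z ≡ u ⊎ z ≡ w
    UW? : Decidable UW
    UW? z with z ≟ u | z ≟ w
    ... | yes z≡u | _       = yes (inj₁ z≡u)
    ... | no z≢u  | yes z≡w = yes (inj₂ z≡w)
    ... | no z≢u  | no z≢w  = no λ { (inj₁ z≡u) → z≢u z≡u ; (inj₂ z≡w) → z≢w z≡w }
    notU : ∀ {e} → ¬ UW (tgt G e) → ¬ tgt G e ≡ u
    notU ¬uw eq = ¬uw (inj₁ eq)
    notW : ∀ {e} → ¬ UW (tgt G e) → ¬ tgt G e ≡ w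
    notW ¬uw eq = ¬uw (inj₂ eq)
    go : (r : Walk G s w) → Avoids u r → ⊥
    go r (s≢u , _) with lastOccurrence UW UW? (reach x)
    ... | inj₁ none = avoids⇒∉ (reach x) (s≢u , All.map notU none) (u-dom-x (reach x))
    ... | inj₂ (z , inj₁ refl , tail , none) =
      let (q , q-avoids-w) = ¬dom⇒avoiding ¬w-dom-u
      in avoids⇒∉ (q ++w tail) (avoids-++ q tail q-avoids-w (All.map notW none)) (w-dom-x (q ++w tail))
    go r r-avoids-u | inj₂ (z , inj₂ refl , tail , none) =
      avoids⇒∉ (r ++w tail) (avoids-++ r tail r-avoids-u (All.map notU none)) (u-dom-x (r ++w tail))

  StrictDom : V → V → Set
  StrictDom x w = Dom w x × ¬ w ≡ x

  strictDom? : ∀ x w → Dec (StrictDom x w)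
  strictDom? x w = dom? w x ×-dec ¬? (w ≟ x)

  deepest : ∀ x b → StrictDom x b → (ws : List V) →
            Σ V λ b' → StrictDom x b' × Dom b b' × (∀ w → w ∈ ws → StrictDom x w → Dom w b')
  deepest x b sb [] = b , sb , dom-refl b , λ _ ()
  deepest x b sb (w ∷ ws) with strictDom? x w
  ... | no ¬sw =
    let (b' , sb' , b-b' , below) = deepest x b sb ws
    in b' , sb' , b-b' , λ { _ (here refl) sw → ⊥-elim (¬sw sw) ; w' (there m) sw' → below w' m sw' }
  ... | yes sw with dom? w b
  ...   | yes w-dom-b =
    let (b' , sb' , b-b' , below) = deepest x b sb ws
    in b' , sb' , b-b' , λ { _ (here refl) _ → dom-trans w-dom-b b-b' ; w' (there m) sw' → below w' m sw' }
  ...   | no ¬w-dom-b =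
    let b-dom-w = comparable w b x (proj₁ sw) (proj₁ sb) ¬w-dom-b
        (b' , sb' , w-b' , below) = deepest x w sw ws
    in b' , sb' , dom-trans b-dom-w w-b' , λ { _ (here refl) _ → w-b' ; w' (there m) sw' → below w' m sw' }

  idom : ∀ x → ¬ x ≡ s → Σ V λ u → IDom G s u x
  idom x x≢s =
    let (u , (u-dom-x , u≢x) , _ , below) = deepest x s (dom-s x , λ s≡x → x≢s (sym s≡x)) (allFin (n G))
    in u , x≢s , u-dom-x , u≢x , λ w w-dom-x w≢x → below w (∈-allFin w) (w-dom-x , w≢x)

  idom-unique : ∀ {u u' x} → IDom G s u x → IDom G s u' x → u ≡ u'
  idom-unique (_ , u-dom , u≢x , u-below) (_ , u'-dom , u'≢x , u'-below) =
    antisym (u'-below _ u-dom u≢x) (u-below _ u'-dom u'≢x)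

  bridge? : ∀ e → Dec (Bridge G s e)
  bridge? e with QReachability.qWalk? G (λ f → ¬? (e ≟ f)) s (tgt G e)
  ... | yes (p , avoids-e) = no λ br → AllP.All¬⇒¬Any avoids-e (br p)
  ... | no none = yes λ p → uses-e p
    where
    uses-e : (p : Walk G s (tgt G e)) → e ∈ edgesOf p
    uses-e p with member? _≟_ e (edgesOf p)
    ... | yes e∈p = e∈p
    ... | no e∉p = ⊥-elim (none (p , AllP.¬Any⇒All¬ _ e∉p))

  marked? : ∀ x → ¬ x ≡ s → Dec (Marked G s x)
  marked? x x≢s with idom x x≢s
  ... | u , iu with any? (λ e → (src G e ≟ u) ×-dec ((tgt G e ≟ x) ×-dec bridge? e))
  ...   | yes (e , se , te , br) = yes (u , iu , e , se , te , br)
  ...   | no none = no λ (u' , iu' , e , se , te , br) → none (e , trans se (idom-unique iu' iu) , te , br)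

  marked≢s : ∀ {x} → Marked G s x → ¬ x ≡ s
  marked≢s (_ , (x≢s , _) , _) = x≢s

  TreeRoot : V → V → Set
  TreeRoot x r = ForestAnc G s r x × (r ≡ s ⊎ Marked G s r)

  -- Climbing from x to its immediate dominator while x is unmarked ends at the
  -- root of T(x); the climb terminates since d(x) has a shorter walk from s.
  treeRoot : ∀ x → Σ V (TreeRoot x)
  treeRoot x = climb x (reach x) (<-wellFounded _)
    where
    climb : ∀ x (p : Walk G s x) → Acc ℕ._<_ (len p) → Σ V (TreeRoot x)
    climb x p (acc shorter) with x ≟ s
    ... | yes x≡s = x , here , inj₁ x≡s
    ... | no x≢s with marked? x x≢s
    ...   | yes mk = x , here , inj₂ mk
    ...   | no ¬mk with idom x x≢s
    ...     | u , iu@(_ , u-dom-x , u≢x , _) with prefix< p (u-dom-x p) u≢x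
    ...       | q , q<p with climb u q (shorter q<p)
    ...         | r , r-anc-u , r-root = r , up iu ¬mk r-anc-u , r-root

  ancestor-dom : ∀ {r y} → ForestAnc G s r y → Dom r y
  ancestor-dom here              = dom-refl _
  ancestor-dom (up iu _ r-anc-u) = dom-trans (ancestor-dom r-anc-u) (proj₁ (proj₂ iu))

  -- A marked dominator a of y dominates every forest ancestor r of y: along the
  -- chain from y up to r, a can only leave the dominators of the current vertex
  -- by being that vertex, which is unmarked.
  marked-dom-ancestor : ∀ {r y a} → Marked G s a → Dom a y → ForestAnc G s r y → Dom a r
  marked-dom-ancestor mk a-dom-y here = a-dom-y
  marked-dom-ancestor {a = a} mk a-dom-y (up {x = y} (_ , _ , _ , below) ¬mk r-anc-u) with a ≟ y
  ... | yes refl = ⊥-elim (¬mk mk)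
  ... | no a≢y = marked-dom-ancestor mk (below a a-dom-y a≢y) r-anc-u

  root-dominates : ∀ {v w r} → TwoEdgeConnected G v w → TreeRoot v r → r ≡ s ⊎ (Marked G s r × Dom r w)
  root-dominates _ (_ , inj₁ r≡s) = inj₁ r≡s
  root-dominates (_ , (q₁ , q₂ , disjoint)) (r-anc-v , inj₂ mk@(_ , _ , _ , _ , refl , br)) =
    inj₂ (mk , bridge-lemma br (ancestor-dom r-anc-v) q₁ q₂ disjoint)

  swap : ∀ {v w} → TwoEdgeConnected G v w → TwoEdgeConnected G w v
  swap (forth , back) = back , forth

  sameTree : ∀ v w → TwoEdgeConnected G v w → SameTree G s v w
  sameTree v w tec with treeRoot v | treeRoot w
  ... | rv , root-v | rw , root-w with rv ≟ rw
  ... | yes refl = rv , proj₁ root-v , proj₁ root-w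
  ... | no rv≢rw = ⊥-elim (roots-equal (root-dominates tec root-v) (root-dominates (swap tec) root-w))
    where
    roots-equal : rv ≡ s ⊎ (Marked G s rv × Dom rv w) → rw ≡ s ⊎ (Marked G s rw × Dom rw v) → ⊥
    roots-equal (inj₁ rv≡s) (inj₁ rw≡s) = rv≢rw (trans rv≡s (sym rw≡s))
    roots-equal (inj₁ refl) (inj₂ (mw , rw-dom-v)) =
      marked≢s mw (dom-of-s (marked-dom-ancestor mw rw-dom-v (proj₁ root-v)))
    roots-equal (inj₂ (mv , rv-dom-w)) (inj₁ refl) =
      marked≢s mv (dom-of-s (marked-dom-ancestor mv rv-dom-w (proj₁ root-w)))
    roots-equal (inj₂ (mv , rv-dom-w)) (inj₂ (mw , rw-dom-v)) =
      rv≢rw (antisym (marked-dom-ancestor mv rv-dom-w (proj₁ root-w))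
                     (marked-dom-ancestor mw rw-dom-v (proj₁ root-v)))

reverseWalk : ∀ {G a b} → Walk G a b → Walk (rev G) b a
reverseWalk []            = []
reverseWalk {G} (e ∷ p)   = Walks._++w_ (rev G) (reverseWalk p) (e ∷ [])

reverseWalk-edges : ∀ {G a b e} (p : Walk G a b) → e ∈ edgesOf (reverseWalk p) → e ∈ edgesOf p
reverseWalk-edges {G} (e ∷ p) m with Walks.∈-edges-++⁻ (rev G) (reverseWalk p) (e ∷ []) m
... | inj₁ m' = there (reverseWalk-edges p m')
... | inj₂ (here refl) = here refl

reverse-twoEdgeConnected : ∀ G {v w} → TwoEdgeConnected G v w → TwoEdgeConnected (rev G) v w
reverse-twoEdgeConnected G ((p₁ , p₂ , dp) , (q₁ , q₂ , dq)) =
  (reverseWalk q₁ , reverseWalk q₂ , λ e m₁ m₂ → dq e (reverseWalk-edges q₁ m₁) (reverseWalk-edges q₂ m₂)) ,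
  (reverseWalk p₁ , reverseWalk p₂ , λ e m₁ m₂ → dp e (reverseWalk-edges p₁ m₁) (reverseWalk-edges p₂ m₂))

lemma4 : (G : Digraph) → StronglyConnected G → (s v w : Vertex G) →
         TwoEdgeConnected G v w →
         SameTree G s v w × SameTree (rev G) s v w
lemma4 G sc s v w tec =
  FlowGraph.sameTree G s (sc s) v w tec ,
  FlowGraph.sameTree (rev G) s (λ x → reverseWalk (sc x s)) v w (reverse-twoEdgeConnected G tec)
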